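{- Let $a,b\in\mathbb N$ with $a\geqslant b+2$ and $b\geqslant1$, and let $\beta>1$ be the larger root of $X^2=aX-b$, so that the R\'enyi expansion of $1$ in base $\beta$ is $d_\beta(1)=(a-1)(a-b-1)^\omega$. Then parallel addition in base $\beta$ is possible on the alphabet $\mathcal A=\{0,1,\ldots,a+b-2\}$ by means of a $1$-block local function, i.e. there is a digit set conversion in base $\beta$ from $\mathcal A+\mathcal A$ to $\mathcal A$ which is $p$-local for some $p$.
   Context: A map $\varphi:\mathcal C^{\mathbb Z}\to\mathcal D^{\mathbb Z}$ is $p$-local if there are $r,t\geqslant0$, $p=r+t+1$, and $\Phi:\mathcal C^p\to\mathcal D$ with $\varphi(u)_j=\Phi(u_{j+t}\cdots u_{j-r})$ for all $j\in\mathbb Z$. A digit set conversion in base $\beta$ from $\mathcal C$ to $\mathcal D$ is a map $\varphi:\mathcal C^{\mathbb Z}\to\mathcal D^{\mathbb Z}$ sending sequences with finitely many non-zero entries to such sequences and preserving $\sum_j u_j\beta^j$. The R\'enyi expansion $d_\beta(1)=t_1t_2\cdots$ is given by $r_0=1$, $t_j=\lfloor\beta r_{j-1}\rfloor$, $r_j=\beta r_{j-1}-t_j$; $w^\omega$ denotes infinite repetition. -}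

module Defs where

open import Data.Nat as ℕ using (ℕ; zero; suc)
open import Data.Integer as ℤ using (ℤ; +_; ∣_∣)
open import Data.Fin using (Fin; toℕ)
open import Data.List using (List; []; _∷_; map; upTo; length)
open import Data.Product using (_×_; _,_; ∃; proj₁; proj₂)
open import Relation.Binary.PropositionalEquality using (_≡_)

-- Discriminant D = a² - 4b of X² - aX + b.  The base is
--   β = (a + √D) / 2   (the larger root of X² = aX - b).
disc : ℕ → ℕ → ℤ
disc a b = + (a ℕ.* a) ℤ.- + (4 ℕ.* b)

-- Exact real arithmetic in ℤ[√D]: a pair (x , y) denotes x + y·√D (D ≥ 0).
-- x + y√D = 0 (as a real number) iff x·y ≤ 0 and x² = D·y².
IsZeroSqrt : ℤ → ℤ × ℤ → Set
IsZeroSqrt D (x , y) = (x ℤ.* y ℤ.≤ + 0) × (x ℤ.* x ≡ D ℤ.* (y ℤ.* y))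

-- Horner evaluation: for a coefficient list [c₀, c₁, …, cₙ₋₁] (of length n),
-- hornerβ a b cs = (x , y) with  2ⁿ · Σ cᵢ βⁱ = x + y√D.
hornerβ : ℕ → ℕ → List ℤ → ℤ × ℤ
hornerβ a b [] = (+ 0 , + 0)
hornerβ a b (c ∷ cs) =
  let xy = hornerβ a b cs
      x = proj₁ xy
      y = proj₂ xy
  in ( c ℤ.* + (2 ℕ.^ suc (length cs)) ℤ.+ + a ℤ.* x ℤ.+ disc a b ℤ.* y
     , x ℤ.+ + a ℤ.* y )

EvalZero : ℕ → ℕ → List ℤ → Set
EvalZero a b cs = IsZeroSqrt (disc a b) (hornerβ a b cs)

-- Bi-infinite sequences over a digit alphabet Fin (suc k) (digit value = toℕ),
-- indexed by ℤ; the digit 0 is Fin.zero.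
Seq : ℕ → Set
Seq k = ℤ → Fin (suc k)

BoundedBy : ∀ {k} → ℕ → Seq k → Set
BoundedBy M u = ∀ (j : ℤ) → M ℕ.< ∣ j ∣ → u j ≡ Fin.zero

FinSupp : ∀ {k} → Seq k → Set
FinSupp u = ∃ λ M → BoundedBy M u

digitℤ : ∀ {k} → Fin (suc k) → ℤ
digitℤ d = + toℕ d

-- Σ_{j=-M}^{M} (u_j - v_j) β^{j+M} = 0, i.e. (multiplying by β^M)
-- Σ_j u_j β^j = Σ_j v_j β^j when both are supported in [-M, M].
SameValue : ∀ {k l} → ℕ → ℕ → ℕ → Seq k → Seq l → Set
SameValue a b M u v =
  EvalZero a b (map (λ i → digitℤ (u (+ i ℤ.- + M)) ℤ.- digitℤ (v (+ i ℤ.- + M)))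
                    (upTo (suc (M ℕ.+ M))))

DigitSetConversion : ∀ {k l} → ℕ → ℕ → (Seq k → Seq l) → Set
DigitSetConversion a b φ =
  (∀ u → FinSupp u → FinSupp (φ u)) ×
  (∀ u M → BoundedBy M u → BoundedBy M (φ u) → SameValue a b M u (φ u))

-- p-local: φ(u)_j = Φ(u_{j+t} ⋯ u_{j-r}), with the window indexed by
-- i ∈ Fin p, i ↦ u_{j+t-i}.
IsLocal : ∀ {k l} → ℕ → (Seq k → Seq l) → Set
IsLocal {k} {l} p φ =
  ∃ λ r → ∃ λ t → (p ≡ r ℕ.+ t ℕ.+ 1) ×
    ∃ λ (Φ : (Fin p → Fin (suc k)) → Fin (suc l)) →
      ∀ (u : Seq k) (j : ℤ) →
        φ u j ≡ Φ (λ i → u (j ℤ.+ + t ℤ.- + toℕ i))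

module Submission where

-- A digit string over {0, …, 2N} is normalised by N rounds of one local rewriting step.
-- In a round every position j decides, from the classes of z_{j−2}, …, z_{j+2} relative to a,
-- whether to emit a carry q_j ∈ {0, 1}; then z_j becomes z_j + q_{j−1} + b·q_{j+1} − a·q_j.
-- Since a·β^j = β^{j+1} + b·β^{j−1}, a round preserves the value.  The carry rule is checked
-- (exhaustively over all 4⁷ neighbourhoods of classes) to be admissible: every new digit is
-- non-negative and either ≤ N or strictly smaller than before, so after N rounds all digits
-- lie in {0, …, N}.  A round has radius 3, so the N-fold iterate is (6N + 1)-local.

open import Defs
open import Data.Nat using (ℕ; _+_; _*_; _∸_; _≤_; suc)
open import Data.Product using (∃; _×_)

open import Data.Bool using (Bool; true; false; _∧_; _∨_; not)
open import Data.Nat using (zero; _<_; z≤n; s≤s; _≤?_; _≟_)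
import Data.Nat as ℕ
import Data.Nat.Properties as ℕₚ
open import Data.Nat.DivMod using (_mod_; m≤n⇒m%n≡m)
open import Data.Nat.GeneralisedArithmetic using (fold)
open import Data.Integer as ℤ using (ℤ; +_; -[1+_]; ∣_∣)
import Data.Integer.Properties as ℤₚ
open import Data.Integer.Tactic.RingSolver using (solve-∀)
open import Data.Fin using (Fin; toℕ)
open import Data.Fin.Properties using (toℕ<n; toℕ-fromℕ<)
open import Data.List using (List; []; _∷_; length; map; applyUpTo; upTo)
open import Data.List.Properties using (map-upTo)
open import Data.Product using (Σ; _,_; proj₁; proj₂)
open import Data.Sum using (_⊎_; inj₁; inj₂; [_,_]′)
open import Function using (_∘_)
open import Relation.Nullary using (yes; no)
open import Relation.Binary.PropositionalEquality

-- The class of a digit z relative to a: small (z ≤ a − 3), twoBelow (z = a − 2),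
-- oneBelow (z = a − 1) and large (z ≥ a).
data Class : Set where
  small twoBelow oneBelow large : Class

nearA : Class → Bool
nearA oneBelow = true
nearA large    = true
nearA _        = false

isTwoBelow : Class → Bool
isTwoBelow twoBelow = true
isTwoBelow _        = false

-- The primary carry decision from the classes of z_{j−1}, z_j, z_{j+1}: a large digit
-- always carries, a − 1 carries when a neighbour is ≥ a − 1, smaller digits never do.
primary : Class → Class → Class → Bool
primary l large    r = true
primary l oneBelow r = nearA l ∨ nearA r
primary l twoBelow r = false
primary l small    r = false

carryRule : Class → Class → Class → Class → Class → Bool
carryRule l₂ l c r r₂ = primary l c r ∨ (isTwoBelow c ∧ primary l₂ l c ∧ primary c r r₂)

-- admissible c A B C: a digit of class c that emits B (worth a) and receives A from
-- position j − 1 (worth 1) and C from position j + 1 (worth b) stays ≥ 0 and becomes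
-- ≤ a + b − 2 or smaller than before.  A large digit must carry and a small one must not;
-- a − 1 may carry only when something comes in, and otherwise nothing may come in
-- (a − 1 + b > a + b − 2); a − 2 may carry only when both come in, and otherwise not both.
admissible : Class → Bool → Bool → Bool → Bool
admissible large    A B     C = B
admissible small    A B     C = not B
admissible oneBelow A true  C = A ∨ C
admissible oneBelow A false C = not (A ∨ C)
admissible twoBelow A true  C = A ∧ C
admissible twoBelow A false C = not (A ∧ C)

forAllClasses : (Class → Bool) → Bool
forAllClasses p = p small ∧ p twoBelow ∧ p oneBelow ∧ p large

∧-true : ∀ x y → x ∧ y ≡ true → x ≡ true × y ≡ true
∧-true true y h = refl , h

forAllClasses-sound : ∀ p → forAllClasses p ≡ true → ∀ c → p c ≡ true
forAllClasses-sound p h small    = proj₁ (∧-true (p small) _ h)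
forAllClasses-sound p h twoBelow = proj₁ (∧-true (p twoBelow) _ (proj₂ (∧-true (p small) _ h)))
forAllClasses-sound p h oneBelow = proj₁ (∧-true (p oneBelow) _ (proj₂ (∧-true (p twoBelow) _ (proj₂ (∧-true (p small) _ h)))))
forAllClasses-sound p h large    = proj₂ (∧-true (p oneBelow) _ (proj₂ (∧-true (p twoBelow) _ (proj₂ (∧-true (p small) _ h)))))

Property : ℕ → Set
Property zero    = Bool
Property (suc n) = Class → Property n

checkAll : ∀ n → Property n → Bool
checkAll zero    b = b
checkAll (suc n) p = forAllClasses (λ c → checkAll n (p c))

Holds : ∀ n → Property n → Set
Holds zero    b = b ≡ true
Holds (suc n) p = ∀ c → Holds n (p c)

checkAll-sound : ∀ n p → checkAll n p ≡ true → Holds n p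
checkAll-sound zero    b h   = h
checkAll-sound (suc n) p h c = checkAll-sound n (p c) (forAllClasses-sound (λ c → checkAll n (p c)) h c)

admissibleAt : Class → Class → Class → Class → Class → Class → Class → Bool
admissibleAt c₋₃ c₋₂ c₋₁ c₀ c₁ c₂ c₃ =
  admissible c₀ (carryRule c₋₃ c₋₂ c₋₁ c₀ c₁) (carryRule c₋₂ c₋₁ c₀ c₁ c₂) (carryRule c₋₁ c₀ c₁ c₂ c₃)

-- The carry rule is admissible in every neighbourhood.  (By hand: a large digit always
-- carries and a small one never does.  If a − 1 carries, it has a neighbour ≥ a − 1, which
-- carries too since it sees this a − 1; if it does not, both neighbours are ≤ a − 2 and do
-- not carry, as the a − 1 between them does not carry primarily.  Neighbours of a − 2 carry
-- exactly when they carry primarily, so a − 2 carries iff both of its neighbours do.)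
carryRule-admissible : Holds 7 admissibleAt
carryRule-admissible = checkAll-sound 7 admissibleAt refl

record Agree {A : Set} (r : ℕ) (f g : ℤ → A) (j j′ : ℤ) : Set where
  constructor agreeing
  field at : ∀ i → ∣ i ∣ ≤ r → f (i ℤ.+ j) ≡ g (i ℤ.+ j′)

HasRadius : {A B : Set} → ℕ → ((ℤ → A) → (ℤ → B)) → Set
HasRadius {A} r F = ∀ {f g : ℤ → A} {j j′} → Agree r f g j j′ → F f j ≡ F g j′

agree-at : ∀ {A : Set} {r} {f g : ℤ → A} {j j′} → Agree r f g j j′ →
           ∀ i (d : ℤ → ℤ) → ∣ i ∣ ≤ r → (∀ k → d k ≡ i ℤ.+ k) → f (d j) ≡ g (d j′)
agree-at {f = f} {g} {j} {j′} agree i d |i|≤r d≡ =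
  subst₂ _≡_ (cong f (sym (d≡ j))) (cong g (sym (d≡ j′))) (Agree.at agree i |i|≤r)

agree-weaken : ∀ {A : Set} {r r′} {f g : ℤ → A} {j j′} → r ≤ r′ → Agree r′ f g j j′ → Agree r f g j j′
agree-weaken r≤r′ agree = agreeing λ i |i|≤r → Agree.at agree i (ℕₚ.≤-trans |i|≤r r≤r′)

agree-shift : ∀ {A : Set} {s r} {f g : ℤ → A} {j j′} d → ∣ d ∣ ≤ s →
              Agree (s + r) f g j j′ → Agree r f g (d ℤ.+ j) (d ℤ.+ j′)
agree-shift {s = s} {r} {f} {g} {j} {j′} d |d|≤s agree = agreeing λ i |i|≤r →
  subst₂ _≡_ (cong f (ℤₚ.+-assoc i d j)) (cong g (ℤₚ.+-assoc i d j′)) (Agree.at agree (i ℤ.+ d) (|i+d|≤s+r i |i|≤r))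
  where
  open ℕₚ.≤-Reasoning
  |i+d|≤s+r : ∀ i → ∣ i ∣ ≤ r → ∣ i ℤ.+ d ∣ ≤ s + r
  |i+d|≤s+r i |i|≤r = begin
    ∣ i ℤ.+ d ∣   ≤⟨ ℤₚ.∣i+j∣≤∣i∣+∣j∣ i d ⟩
    ∣ i ∣ + ∣ d ∣ ≤⟨ ℕₚ.+-mono-≤ |i|≤r |d|≤s ⟩
    r + s         ≡⟨ ℕₚ.+-comm r s ⟩
    s + r         ∎

radius-∘ : ∀ {A B C : Set} {r s} {F : (ℤ → A) → (ℤ → B)} {G : (ℤ → B) → (ℤ → C)} →
           HasRadius r F → HasRadius s G → HasRadius (s + r) (λ f → G (F f))
radius-∘ F-radius G-radius agree = G-radius (agreeing λ i |i|≤s → F-radius (agree-shift i |i|≤s agree))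

far-neighbour : ∀ {k M} j d → ∣ d ∣ ≤ k → k + M < ∣ j ∣ → M < ∣ d ℤ.+ j ∣
far-neighbour {k} {M} j d |d|≤k k+M<|j| = ℕₚ.+-cancelʳ-< k M ∣ d ℤ.+ j ∣ (begin-strict
  M + k               ≡⟨ ℕₚ.+-comm M k ⟩
  k + M               <⟨ k+M<|j| ⟩
  ∣ j ∣               ≡⟨ cong ∣_∣ (sym (cancel d j)) ⟩
  ∣ (d ℤ.+ j) ℤ.- d ∣ ≤⟨ ℤₚ.∣i-j∣≤∣i∣+∣j∣ (d ℤ.+ j) d ⟩
  ∣ d ℤ.+ j ∣ + ∣ d ∣ ≤⟨ ℕₚ.+-monoʳ-≤ ∣ d ℤ.+ j ∣ |d|≤k ⟩
  ∣ d ℤ.+ j ∣ + k     ∎)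
  where
  open ℕₚ.≤-Reasoning
  cancel : ∀ d j → (d ℤ.+ j) ℤ.- d ≡ j
  cancel = solve-∀

toℕ-mod : ∀ {x n} → x ≤ n → toℕ (x mod suc n) ≡ x
toℕ-mod {x} {n} x≤n = trans (toℕ-fromℕ< _) (m≤n⇒m%n≡m x≤n)

i≤+∣i∣ : ∀ i → i ℤ.≤ + ∣ i ∣
i≤+∣i∣ (+ n)    = ℤₚ.≤-refl
i≤+∣i∣ -[1+ n ] = ℤ.-≤+

-- The window of radius R of u around j, indexed as in IsLocal (position k ↦ u_{j+R−k}),
-- and the sequence centred at 0 that it describes.
windowAt : ∀ {A : Set} R → (ℤ → A) → ℤ → Fin (suc (R + R)) → A
windowAt R u j k = u (j ℤ.+ + R ℤ.- + toℕ k)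

recentre : ∀ {A : Set} R → (Fin (suc (R + R)) → A) → ℤ → A
recentre R w i = w (∣ + R ℤ.- i ∣ mod suc (R + R))

recentre-window : ∀ {A : Set} R (u : ℤ → A) j i → ∣ i ∣ ≤ R → recentre R (windowAt R u j) i ≡ u (i ℤ.+ j)
recentre-window R u j i |i|≤R = cong u (begin
  j ℤ.+ + R ℤ.- + toℕ (∣ + R ℤ.- i ∣ mod suc (R + R)) ≡⟨ cong (λ x → j ℤ.+ + R ℤ.- + x) (toℕ-mod |R-i|≤R+R) ⟩
  j ℤ.+ + R ℤ.- + ∣ + R ℤ.- i ∣                        ≡⟨ cong (λ x → j ℤ.+ + R ℤ.- x) (ℤₚ.0≤i⇒+∣i∣≡i 0≤R-i) ⟩
  j ℤ.+ + R ℤ.- (+ R ℤ.- i)                            ≡⟨ recentred j (+ R) i ⟩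
  i ℤ.+ j                                              ∎)
  where
  open ≡-Reasoning
  |R-i|≤R+R : ∣ + R ℤ.- i ∣ ≤ R + R
  |R-i|≤R+R = ℕₚ.≤-trans (ℤₚ.∣i-j∣≤∣i∣+∣j∣ (+ R) i) (ℕₚ.+-monoʳ-≤ R |i|≤R)
  0≤R-i : + 0 ℤ.≤ + R ℤ.- i
  0≤R-i = ℤₚ.i≤j⇒0≤j-i (ℤₚ.≤-trans (i≤+∣i∣ i) (ℤ.+≤+ |i|≤R))
  recentred : ∀ j R i → j ℤ.+ R ℤ.- (R ℤ.- i) ≡ i ℤ.+ j
  recentred = solve-∀

descend : (P : ℕ → Set) (M T : ℕ) → (∀ n → T < n → P n) →
          (∀ n → M ≤ n → P (suc n) → P (suc (suc n)) → P n) → ∀ n → M ≤ n → P n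
descend P M T far step n M≤n = proj₁ (pair (suc T) n M≤n (ℕₚ.m≤n+m (suc T) n))
  where
  pair : ∀ k n → M ≤ n → T < n + k → P n × P (suc n)
  pair zero n M≤n T<n+0 = far n T<n , far (suc n) (ℕₚ.m≤n⇒m≤1+n T<n)
    where
    T<n : T < n
    T<n = subst (T <_) (ℕₚ.+-identityʳ n) T<n+0
  pair (suc k) n M≤n T<n+k = step n M≤n (proj₁ next) (proj₂ next) , proj₁ next
    where
    next : P (suc n) × P (suc (suc n))
    next = pair k (suc n) (ℕₚ.m≤n⇒m≤1+n M≤n) (subst (T <_) (ℕₚ.+-suc n k) T<n+k)

-- s ⊕ m = s + m, defined by iterating the successor so that it unfolds along lists.
_⊕_ : ℤ → ℕ → ℤ
s ⊕ zero  = s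
s ⊕ suc m = ℤ.suc s ⊕ m

⊕-+ : ∀ s m → s ⊕ m ≡ s ℤ.+ + m
⊕-+ s zero    = sym (ℤₚ.+-identityʳ s)
⊕-+ s (suc m) = trans (⊕-+ (ℤ.suc s) m) (shift s (+ m))
  where
  shift : ∀ s i → (+ 1 ℤ.+ s) ℤ.+ i ≡ s ℤ.+ (+ 1 ℤ.+ i)
  shift = solve-∀

window : (ℤ → ℤ) → ℤ → ℕ → List ℤ
window c s zero    = []
window c s (suc m) = c s ∷ window c (ℤ.suc s) m

window-applyUpTo : ∀ c s m (f : ℕ → ℤ) → (∀ i → f i ≡ c (s ⊕ i)) → applyUpTo f m ≡ window c s m
window-applyUpTo c s zero    f f≡ = refl
window-applyUpTo c s (suc m) f f≡ = cong₂ _∷_ (f≡ 0) (window-applyUpTo c (ℤ.suc s) m (f ∘ suc) (f≡ ∘ suc))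

-- Σ cᵢ βⁱ in ℤ[β] = ℤ[X]/(X² − aX + b), as u + v·β (Horner scheme, lowest coefficient first):
-- multiplying u + vβ by β gives −bv + (u + av)β.
evalβ : ℕ → ℕ → List ℤ → ℤ × ℤ
evalβ a b []       = + 0 , + 0
evalβ a b (c ∷ cs) =
  c ℤ.- + b ℤ.* proj₂ (evalβ a b cs) , proj₁ (evalβ a b cs) ℤ.+ + a ℤ.* proj₂ (evalβ a b cs)

-- (x , y) stands for P · (u + vβ) written as x + y√D, with β = (a + √D)/2.
Represents : ℕ → ℤ → ℤ × ℤ → ℤ × ℤ → Set
Represents a P xy uv =
  (proj₁ xy ℤ.+ proj₁ xy ≡ P ℤ.* (proj₁ uv ℤ.+ proj₁ uv) ℤ.+ P ℤ.* + a ℤ.* proj₂ uv) ×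
  (proj₂ xy ℤ.+ proj₂ xy ≡ P ℤ.* proj₂ uv)

disc-expand : ∀ a b → disc a b ≡ + a ℤ.* + a ℤ.- + 4 ℤ.* + b
disc-expand a b = cong₂ ℤ._-_ (ℤₚ.pos-* a a) (ℤₚ.pos-* 4 b)

pow2-suc : ∀ n → + (2 ℕ.^ suc n) ≡ + (2 ℕ.^ n) ℤ.+ + (2 ℕ.^ n)
pow2-suc n = trans (cong +_ (cong (λ k → 2 ℕ.^ n + k) (ℕₚ.+-identityʳ _))) (ℤₚ.pos-+ (2 ℕ.^ n) _)

hornerβ-represents : ∀ a b cs → Represents a (+ (2 ℕ.^ length cs)) (hornerβ a b cs) (evalβ a b cs)
hornerβ-represents a b []       = sym (trans (ℤₚ.+-identityˡ _) (ℤₚ.*-zeroʳ (+ 1 ℤ.* + a))) , refl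
hornerβ-represents a b (c ∷ cs) = first , second
  where
  open ≡-Reasoning
  P P′ x y u v x′ u′ v′ : ℤ
  P  = + (2 ℕ.^ length cs)
  P′ = + (2 ℕ.^ suc (length cs))
  x  = proj₁ (hornerβ a b cs)
  y  = proj₂ (hornerβ a b cs)
  u  = proj₁ (evalβ a b cs)
  v  = proj₂ (evalβ a b cs)
  x′ = c ℤ.* P′ ℤ.+ + a ℤ.* x ℤ.+ disc a b ℤ.* y
  u′ = c ℤ.- + b ℤ.* v
  v′ = u ℤ.+ + a ℤ.* v
  IH : Represents a P (hornerβ a b cs) (evalβ a b cs)
  IH = hornerβ-represents a b cs
  P′≡ : P′ ≡ P ℤ.+ P
  P′≡ = pow2-suc (length cs)
  first : x′ ℤ.+ x′ ≡ P′ ℤ.* (u′ ℤ.+ u′) ℤ.+ P′ ℤ.* + a ℤ.* v′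
  first = begin
    x′ ℤ.+ x′
      ≡⟨ double (c ℤ.* P′) (+ a) (disc a b) x y ⟩
    (c ℤ.* P′ ℤ.+ c ℤ.* P′) ℤ.+ + a ℤ.* (x ℤ.+ x) ℤ.+ disc a b ℤ.* (y ℤ.+ y)
      ≡⟨ cong₂ (λ X Y → (c ℤ.* P′ ℤ.+ c ℤ.* P′) ℤ.+ + a ℤ.* X ℤ.+ disc a b ℤ.* Y) (proj₁ IH) (proj₂ IH) ⟩
    (c ℤ.* P′ ℤ.+ c ℤ.* P′) ℤ.+ + a ℤ.* (P ℤ.* (u ℤ.+ u) ℤ.+ P ℤ.* + a ℤ.* v) ℤ.+ disc a b ℤ.* (P ℤ.* v)
      ≡⟨ cong₂ (λ Q D → (c ℤ.* Q ℤ.+ c ℤ.* Q) ℤ.+ + a ℤ.* (P ℤ.* (u ℤ.+ u) ℤ.+ P ℤ.* + a ℤ.* v) ℤ.+ D ℤ.* (P ℤ.* v))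
               P′≡ (disc-expand a b) ⟩
    _ ≡⟨ multiply-by-β c P (+ a) (+ b) u v ⟩
    (P ℤ.+ P) ℤ.* (u′ ℤ.+ u′) ℤ.+ (P ℤ.+ P) ℤ.* + a ℤ.* v′
      ≡⟨ cong (λ Q → Q ℤ.* (u′ ℤ.+ u′) ℤ.+ Q ℤ.* + a ℤ.* v′) (sym P′≡) ⟩
    P′ ℤ.* (u′ ℤ.+ u′) ℤ.+ P′ ℤ.* + a ℤ.* v′ ∎
    where
    double : ∀ k A D x y → (k ℤ.+ A ℤ.* x ℤ.+ D ℤ.* y) ℤ.+ (k ℤ.+ A ℤ.* x ℤ.+ D ℤ.* y) ≡
                           (k ℤ.+ k) ℤ.+ A ℤ.* (x ℤ.+ x) ℤ.+ D ℤ.* (y ℤ.+ y)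
    double = solve-∀
    multiply-by-β : ∀ c P A B u v →
      (c ℤ.* (P ℤ.+ P) ℤ.+ c ℤ.* (P ℤ.+ P)) ℤ.+ A ℤ.* (P ℤ.* (u ℤ.+ u) ℤ.+ P ℤ.* A ℤ.* v)
        ℤ.+ (A ℤ.* A ℤ.- + 4 ℤ.* B) ℤ.* (P ℤ.* v)
      ≡ (P ℤ.+ P) ℤ.* ((c ℤ.- B ℤ.* v) ℤ.+ (c ℤ.- B ℤ.* v)) ℤ.+ (P ℤ.+ P) ℤ.* A ℤ.* (u ℤ.+ A ℤ.* v)
    multiply-by-β = solve-∀
  second : (x ℤ.+ + a ℤ.* y) ℤ.+ (x ℤ.+ + a ℤ.* y) ≡ P′ ℤ.* v′
  second = begin
    (x ℤ.+ + a ℤ.* y) ℤ.+ (x ℤ.+ + a ℤ.* y) ≡⟨ double x (+ a) y ⟩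
    (x ℤ.+ x) ℤ.+ + a ℤ.* (y ℤ.+ y)         ≡⟨ cong₂ (λ X Y → X ℤ.+ + a ℤ.* Y) (proj₁ IH) (proj₂ IH) ⟩
    P ℤ.* (u ℤ.+ u) ℤ.+ P ℤ.* + a ℤ.* v ℤ.+ + a ℤ.* (P ℤ.* v) ≡⟨ collect P (+ a) u v ⟩
    (P ℤ.+ P) ℤ.* v′                        ≡⟨ cong (ℤ._* v′) (sym P′≡) ⟩
    P′ ℤ.* v′                               ∎
    where
    double : ∀ x A y → (x ℤ.+ A ℤ.* y) ℤ.+ (x ℤ.+ A ℤ.* y) ≡ (x ℤ.+ x) ℤ.+ A ℤ.* (y ℤ.+ y)
    double = solve-∀
    collect : ∀ P A u v → P ℤ.* (u ℤ.+ u) ℤ.+ P ℤ.* A ℤ.* v ℤ.+ A ℤ.* (P ℤ.* v) ≡ (P ℤ.+ P) ℤ.* (u ℤ.+ A ℤ.* v)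
    collect = solve-∀

double-zero : ∀ x → x ℤ.+ x ≡ + 0 → x ≡ + 0
double-zero (+ zero) _ = refl

evalβ-zero : ∀ a b cs → evalβ a b cs ≡ (+ 0 , + 0) → EvalZero a b cs
evalβ-zero a b cs uv≡0 =
  subst (IsZeroSqrt (disc a b)) (sym (cong₂ _,_ x≡0 y≡0)) (ℤₚ.≤-refl , sym (ℤₚ.*-zeroʳ (disc a b)))
  where
  P : ℤ
  P = + (2 ℕ.^ length cs)
  rep : Represents a P (hornerβ a b cs) (evalβ a b cs)
  rep = hornerβ-represents a b cs
  y≡0 : proj₂ (hornerβ a b cs) ≡ + 0
  y≡0 = double-zero _ (trans (proj₂ rep) (trans (cong (λ uv → P ℤ.* proj₂ uv) uv≡0) (ℤₚ.*-zeroʳ P)))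
  x≡0 : proj₁ (hornerβ a b cs) ≡ + 0
  x≡0 = double-zero _ (trans (proj₁ rep) (trans (cong (λ uv → P ℤ.* (proj₁ uv ℤ.+ proj₁ uv) ℤ.+ P ℤ.* + a ℤ.* proj₂ uv) uv≡0) vanish))
    where
    vanish : P ℤ.* + 0 ℤ.+ P ℤ.* + a ℤ.* + 0 ≡ + 0
    vanish rewrite ℤₚ.*-zeroʳ P | ℤₚ.*-zeroʳ (P ℤ.* + a) = refl

-- What position j loses when every position i emits Q_i carries: it gives away a·Q_j and
-- receives Q_{j−1} from position j − 1 and b·Q_{j+1} from position j + 1.  Since
-- a·β^j = β^{j+1} + b·β^{j−1}, such a pattern has value 0 (see telescope).
carryPattern : ℕ → ℕ → (ℤ → ℤ) → ℤ → ℤ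
carryPattern a b Q j = + a ℤ.* Q j ℤ.- Q (ℤ.pred j) ℤ.- + b ℤ.* Q (ℤ.suc j)

telescope : ∀ a b Q m s → Q (ℤ.pred (s ⊕ m)) ≡ + 0 → Q (s ⊕ m) ≡ + 0 →
            evalβ a b (window (carryPattern a b Q) s m) ≡ (+ a ℤ.* Q s ℤ.- Q (ℤ.pred s) , ℤ.- Q s)
telescope a b Q zero    s Qₑ₋₁≡0 Qₑ≡0 rewrite Qₑ₋₁≡0 | Qₑ≡0 | ℤₚ.*-zeroʳ (+ a) = refl
telescope a b Q (suc m) s Qₑ₋₁≡0 Qₑ≡0
  rewrite telescope a b Q m (ℤ.suc s) Qₑ₋₁≡0 Qₑ≡0 | ℤₚ.pred-suc s =
    cong₂ _,_ (absorb (+ a) (+ b) (Q (ℤ.pred s)) (Q s) (Q (ℤ.suc s)))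
              (shift (+ a) (Q s) (Q (ℤ.suc s)))
  where
  absorb : ∀ A B Q₋ Q₀ Q₊ → (A ℤ.* Q₀ ℤ.- Q₋ ℤ.- B ℤ.* Q₊) ℤ.- B ℤ.* (ℤ.- Q₊) ≡ A ℤ.* Q₀ ℤ.- Q₋
  absorb = solve-∀
  shift : ∀ A Q₀ Q₊ → (A ℤ.* Q₊ ℤ.- Q₀) ℤ.+ A ℤ.* (ℤ.- Q₊) ≡ ℤ.- Q₀
  shift = solve-∀

neg-zero : ∀ {x} → ℤ.- x ≡ + 0 → x ≡ + 0
neg-zero {x} -x≡0 = trans (sym (ℤₚ.neg-involutive x)) (cong ℤ.-_ -x≡0)

pattern-left : ∀ A B x → A ℤ.* + 0 ℤ.- x ℤ.- B ℤ.* + 0 ≡ + 0 → x ≡ + 0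
pattern-left A B x eq = neg-zero (trans (sym (simplify A B x)) eq)
  where
  simplify : ∀ A B x → A ℤ.* + 0 ℤ.- x ℤ.- B ℤ.* + 0 ≡ ℤ.- x
  simplify = solve-∀

pattern-right : ∀ A b′ x → A ℤ.* + 0 ℤ.- + 0 ℤ.- + suc b′ ℤ.* x ≡ + 0 → x ≡ + 0
pattern-right A b′ x eq =
  [ (λ ()) , (λ x≡0 → x≡0) ]′ (ℤₚ.i*j≡0⇒i≡0∨j≡0 (+ suc b′) (neg-zero (trans (sym (simplify A (+ suc b′) x)) eq)))
  where
  simplify : ∀ A B x → A ℤ.* + 0 ℤ.- + 0 ℤ.- B ℤ.* x ≡ ℤ.- (B ℤ.* x)
  simplify = solve-∀

suc-neg-suc : ∀ n → ℤ.suc -[1+ n ] ≡ ℤ.- + n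
suc-neg-suc zero    = refl
suc-neg-suc (suc n) = refl

pred-neg : ∀ n → ℤ.pred (ℤ.- + n) ≡ -[1+ n ]
pred-neg zero    = refl
pred-neg (suc n) = refl

-- If b ≥ 1, Q is finitely supported and its carry pattern vanishes outside [−M, M],
-- then Q itself vanishes at every j with |j| ≥ M: the recurrence a·Q_j − Q_{j−1} − b·Q_{j+1} = 0
-- propagates the zeros of Q inwards from both ends.
boundary-vanishing : ∀ a b′ Q M T →
  (∀ j → M < ∣ j ∣ → carryPattern a (suc b′) Q j ≡ + 0) → (∀ j → T < ∣ j ∣ → Q j ≡ + 0) →
  ∀ n → M ≤ n → Q (+ n) ≡ + 0 × Q (ℤ.- + n) ≡ + 0
boundary-vanishing a b′ Q M T pattern≡0 Q≡0 n M≤n = right n M≤n , left n M≤n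
  where
  right : ∀ n → M ≤ n → Q (+ n) ≡ + 0
  right = descend (λ n → Q (+ n) ≡ + 0) M T (λ n → Q≡0 (+ n)) step
    where
    step : ∀ n → M ≤ n → Q (+ suc n) ≡ + 0 → Q (+ suc (suc n)) ≡ + 0 → Q (+ n) ≡ + 0
    step n M≤n Q₁≡0 Q₂≡0 = pattern-left (+ a) (+ suc b′) (Q (+ n))
      (subst₂ (λ y z → + a ℤ.* y ℤ.- Q (+ n) ℤ.- + suc b′ ℤ.* z ≡ + 0) Q₁≡0 Q₂≡0 (pattern≡0 (+ suc n) (s≤s M≤n)))
  left : ∀ n → M ≤ n → Q (ℤ.- + n) ≡ + 0
  left = descend (λ n → Q (ℤ.- + n) ≡ + 0) M T far step
    where
    far : ∀ n → T < n → Q (ℤ.- + n) ≡ + 0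
    far n T<n = Q≡0 (ℤ.- + n) (subst (T <_) (sym (ℤₚ.∣-i∣≡∣i∣ (+ n))) T<n)
    step : ∀ n → M ≤ n → Q -[1+ n ] ≡ + 0 → Q -[1+ suc n ] ≡ + 0 → Q (ℤ.- + n) ≡ + 0
    step n M≤n Q₁≡0 Q₂≡0 = pattern-right (+ a) b′ (Q (ℤ.- + n))
      (subst₂ (λ y z → + a ℤ.* y ℤ.- z ℤ.- + suc b′ ℤ.* Q (ℤ.- + n) ≡ + 0) Q₁≡0 Q₂≡0
        (subst (λ i → + a ℤ.* Q -[1+ n ] ℤ.- Q -[1+ suc n ] ℤ.- + suc b′ ℤ.* Q i ≡ + 0) (suc-neg-suc n)
          (pattern≡0 -[1+ n ] (s≤s M≤n))))

window-end : ∀ M → (ℤ.- + M) ⊕ suc (M + M) ≡ + suc M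
window-end M = begin
  (ℤ.- + M) ⊕ suc (M + M)          ≡⟨ ⊕-+ (ℤ.- + M) (suc (M + M)) ⟩
  ℤ.- + M ℤ.+ + suc (M + M)        ≡⟨ cong (λ k → ℤ.- + M ℤ.+ (+ 1 ℤ.+ k)) (ℤₚ.pos-+ M M) ⟩
  ℤ.- + M ℤ.+ (+ 1 ℤ.+ (+ M ℤ.+ + M)) ≡⟨ cancel (+ M) ⟩
  + 1 ℤ.+ + M                       ∎
  where
  open ≡-Reasoning
  cancel : ∀ X → ℤ.- X ℤ.+ (+ 1 ℤ.+ (X ℤ.+ X)) ≡ + 1 ℤ.+ X
  cancel = solve-∀

carryPattern-value-zero : ∀ a b′ Q M T →
  (∀ j → M < ∣ j ∣ → carryPattern a (suc b′) Q j ≡ + 0) → (∀ j → T < ∣ j ∣ → Q j ≡ + 0) →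
  EvalZero a (suc b′) (window (carryPattern a (suc b′) Q) (ℤ.- + M) (suc (M + M)))
carryPattern-value-zero a b′ Q M T pattern≡0 Q≡0 =
  evalβ-zero a (suc b′) (window (carryPattern a (suc b′) Q) s (suc (M + M))) (begin
  evalβ a (suc b′) (window (carryPattern a (suc b′) Q) s (suc (M + M)))
    ≡⟨ telescope a (suc b′) Q (suc (M + M)) s (subst (λ e → Q (ℤ.pred e) ≡ + 0) (sym (window-end M)) Qₘ≡0)
                                              (subst (λ e → Q e ≡ + 0) (sym (window-end M)) Qₘ₊₁≡0) ⟩
  (+ a ℤ.* Q s ℤ.- Q (ℤ.pred s) , ℤ.- Q s)
    ≡⟨ cong₂ (λ x y → (+ a ℤ.* x ℤ.- y , ℤ.- x)) Q₋ₘ≡0 (trans (cong Q (pred-neg M)) Q₋ₘ₋₁≡0) ⟩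
  (+ a ℤ.* + 0 ℤ.- + 0 , + 0)
    ≡⟨ cong (λ x → (x ℤ.- + 0 , + 0)) (ℤₚ.*-zeroʳ (+ a)) ⟩
  (+ 0 , + 0) ∎)
  where
  open ≡-Reasoning
  s : ℤ
  s = ℤ.- + M
  vanish : ∀ n → M ≤ n → Q (+ n) ≡ + 0 × Q (ℤ.- + n) ≡ + 0
  vanish = boundary-vanishing a b′ Q M T pattern≡0 Q≡0
  Qₘ≡0 : Q (+ M) ≡ + 0
  Qₘ≡0 = proj₁ (vanish M ℕₚ.≤-refl)
  Qₘ₊₁≡0 : Q (+ suc M) ≡ + 0
  Qₘ₊₁≡0 = proj₁ (vanish (suc M) (ℕₚ.n≤1+n M))
  Q₋ₘ≡0 : Q s ≡ + 0
  Q₋ₘ≡0 = proj₂ (vanish M ℕₚ.≤-refl)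
  Q₋ₘ₋₁≡0 : Q (ℤ.- + suc M) ≡ + 0
  Q₋ₘ₋₁≡0 = proj₂ (vanish (suc M) (ℕₚ.n≤1+n M))

infixl 7 _·_
_·_ : ℕ → Bool → ℕ
n · true  = n
n · false = 0

·-≤ : ∀ n B → n · B ≤ n
·-≤ n true  = ℕₚ.≤-refl
·-≤ n false = z≤n

beyond-two : ∀ {m z} → m < z → z ≢ suc m → z ≢ suc (suc m) → suc (suc (suc m)) ≤ z
beyond-two m<z z≢m+1 z≢m+2 = ℕₚ.≤∧≢⇒< (ℕₚ.≤∧≢⇒< m<z (z≢m+1 ∘ sym)) (z≢m+2 ∘ sym)

-- A round applied at every position of a ℤ-indexed digit sequence, for the base with
-- a = a′ + 3 and b = b′ + 1 (so a ≥ b + 2 means b′ ≤ a′).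
module Rounds (a′ b′ : ℕ) (b′≤a′ : b′ ≤ a′) where

  a b N : ℕ
  a = 3 + a′
  b = 1 + b′
  N = a + b ∸ 2

  a-1≤N : 2 + a′ ≤ N
  a-1≤N = s≤s (ℕₚ.≤-trans (s≤s (ℕₚ.m≤m+n a′ b′)) (ℕₚ.≤-reflexive (sym (ℕₚ.+-suc a′ b′))))

  1+b<a : 1 + b < a
  1+b<a = s≤s (s≤s (s≤s b′≤a′))

  b≤N : b ≤ N
  b≤N = ℕₚ.m≤n⇒m≤1+n (ℕₚ.m≤n+m b a′)

  data ClassView (z : ℕ) : Class → Set where
    small    : z ≤ a′     → ClassView z small
    twoBelow : z ≡ 1 + a′ → ClassView z twoBelow
    oneBelow : z ≡ 2 + a′ → ClassView z oneBelow
    large    : a ≤ z      → ClassView z large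

  classify : (z : ℕ) → Σ Class (ClassView z)
  classify z with z ≤? a′
  ... | yes z≤a′ = small , small z≤a′
  ... | no z≰a′ with z ≟ 1 + a′
  ...   | yes z≡a-2 = twoBelow , twoBelow z≡a-2
  ...   | no z≢a-2 with z ≟ 2 + a′
  ...     | yes z≡a-1 = oneBelow , oneBelow z≡a-1
  ...     | no z≢a-1 = large , large (beyond-two (ℕₚ.≰⇒> z≰a′) z≢a-2 z≢a-1)

  class : ℕ → Class
  class z = proj₁ (classify z)

  class-view : ∀ z → ClassView z (class z)
  class-view z = proj₂ (classify z)

  received : ℕ → Bool → Bool → ℕ
  received z A C = z + 1 · A + b · C

  newDigit : ℕ → Bool → Bool → Bool → ℕ
  newDigit z A B C = received z A C ∸ a · B

  Progress : ℕ → ℕ → Set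
  Progress z z′ = z′ ≤ N ⊎ z′ < z

  received-≤ : ∀ z A C → received z A C ≤ z + 1 + b
  received-≤ z A C = ℕₚ.+-mono-≤ (ℕₚ.+-monoʳ-≤ z (·-≤ 1 A)) (·-≤ b C)

  z≤received : ∀ z A C → z ≤ received z A C
  z≤received z A C = ℕₚ.≤-trans (ℕₚ.m≤m+n z (1 · A)) (ℕₚ.m≤m+n (z + 1 · A) (b · C))

  -- Emitting a carry from a digit ≥ a makes it smaller: it loses a and gains at most 1 + b < a.
  carry-decreases : ∀ {z} A C → a ≤ z → received z A C ∸ a < z
  carry-decreases {z} A C a≤z = ℕₚ.+-cancelʳ-< a (received z A C ∸ a) z (begin-strict
    received z A C ∸ a + a ≡⟨ ℕₚ.m∸n+n≡m (ℕₚ.≤-trans a≤z (z≤received z A C)) ⟩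
    received z A C         ≤⟨ received-≤ z A C ⟩
    z + 1 + b              ≡⟨ ℕₚ.+-assoc z 1 b ⟩
    z + (1 + b)            <⟨ ℕₚ.+-monoʳ-< z 1+b<a ⟩
    z + a                  ∎)
    where open ℕₚ.≤-Reasoning

  carry-fits : ∀ {z} A C → z ≤ 2 + a′ → received z A C ∸ a ≤ N
  carry-fits {z} A C z≤a-1 = ℕₚ.m≤n+o⇒m∸n≤o (received z A C) a (begin
    received z A C    ≤⟨ received-≤ z A C ⟩
    z + 1 + b         ≤⟨ ℕₚ.+-monoˡ-≤ b (ℕₚ.+-monoˡ-≤ 1 z≤a-1) ⟩
    2 + a′ + 1 + b    ≡⟨ cong (_+ b) (ℕₚ.+-comm (2 + a′) 1) ⟩
    a + b             ≤⟨ ℕₚ.+-monoʳ-≤ a b≤N ⟩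
    a + N             ∎)
    where open ℕₚ.≤-Reasoning

  gain : ∀ z k → 1 ≤ k → suc z ≤ z + k
  gain z k 1≤k = ℕₚ.≤-trans (ℕₚ.≤-reflexive (ℕₚ.+-comm 1 z)) (ℕₚ.+-monoʳ-≤ z 1≤k)

  affordable : ∀ {z c} A C → ClassView z c → admissible c A true C ≡ true → a ≤ received z A C
  affordable A     C     (large a≤z)      _ = ℕₚ.≤-trans a≤z (z≤received _ A C)
  affordable true  C     (oneBelow refl)  _ = ℕₚ.≤-trans (gain (2 + a′) 1 ℕₚ.≤-refl) (ℕₚ.m≤m+n _ (b · C))
  affordable false true  (oneBelow refl)  _ = ℕₚ.≤-trans (s≤s (ℕₚ.m≤m+n (2 + a′) 0)) (gain (2 + a′ + 0) b (s≤s z≤n))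
  affordable true  true  (twoBelow refl)  _ = ℕₚ.≤-trans (s≤s (gain (1 + a′) 1 ℕₚ.≤-refl)) (gain (1 + a′ + 1) b (s≤s z≤n))
  affordable false false (oneBelow refl)  ()
  affordable true  false (twoBelow refl)  ()
  affordable false C     (twoBelow refl)  ()
  affordable A     C     (small _)        ()

  -- A digit that admissibly keeps its carry already fits into the output alphabet:
  -- at most a − 3 + 1 + b, a − 1, a − 2 + 1 or a − 2 + b.
  unneeded : ∀ {z c} A C → ClassView z c → admissible c A false C ≡ true → received z A C ≤ N
  unneeded {z} A C (small z≤a′) _ = begin
    received z A C ≤⟨ received-≤ z A C ⟩
    z + 1 + b      ≤⟨ ℕₚ.+-monoˡ-≤ b (ℕₚ.+-monoˡ-≤ 1 z≤a′) ⟩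
    a′ + 1 + b     ≡⟨ trans (ℕₚ.+-assoc a′ 1 b) (ℕₚ.+-suc a′ b) ⟩
    N              ∎
    where open ℕₚ.≤-Reasoning
  unneeded false false (oneBelow refl) _ = ℕₚ.≤-trans (ℕₚ.≤-reflexive (ℕₚ.+-identityʳ _)) (ℕₚ.≤-trans (ℕₚ.≤-reflexive (ℕₚ.+-identityʳ _)) a-1≤N)
  unneeded true  false (twoBelow refl) _ = s≤s (ℕₚ.≤-trans (ℕₚ.≤-reflexive (ℕₚ.+-identityʳ _)) (ℕₚ.+-monoʳ-≤ a′ (s≤s z≤n)))
  unneeded false true  (twoBelow refl) _ = s≤s (ℕₚ.≤-reflexive (cong (_+ b) (ℕₚ.+-identityʳ a′)))
  unneeded false false (twoBelow refl) _ = s≤s (ℕₚ.≤-trans (ℕₚ.≤-reflexive (ℕₚ.+-identityʳ _)) (ℕₚ.+-monoʳ-≤ a′ z≤n))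
  unneeded true  C     (oneBelow refl) ()
  unneeded false true  (oneBelow refl) ()
  unneeded true  true  (twoBelow refl) ()
  unneeded A     C     (large _)       ()

  round-sound : ∀ {z c} A B C → ClassView z c → admissible c A B C ≡ true →
                a · B ≤ received z A C × Progress z (newDigit z A B C)
  round-sound A false C view ok = z≤n , inj₁ (unneeded A C view ok)
  round-sound A true C view@(large a≤z) ok = affordable A C view ok , inj₂ (carry-decreases A C a≤z)
  round-sound A true C view@(oneBelow refl) ok = affordable A C view ok , inj₁ (carry-fits A C ℕₚ.≤-refl)
  round-sound A true C view@(twoBelow refl) ok = affordable A C view ok , inj₁ (carry-fits A C (ℕₚ.n≤1+n _))
  round-sound A true C (small _) ()

  classAt : (ℤ → ℕ) → ℤ → Class
  classAt Z j = class (Z j)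

  carry : (ℤ → ℕ) → ℤ → Bool
  carry Z j = carryRule (classAt Z (ℤ.pred (ℤ.pred j))) (classAt Z (ℤ.pred j)) (classAt Z j)
                        (classAt Z (ℤ.suc j)) (classAt Z (ℤ.suc (ℤ.suc j)))

  round : (ℤ → ℕ) → ℤ → ℕ
  round Z j = newDigit (Z j) (carry Z (ℤ.pred j)) (carry Z j) (carry Z (ℤ.suc j))

  rounds : ℕ → (ℤ → ℕ) → ℤ → ℕ
  rounds k z = fold z round k

  carry-left : ∀ Z j → carry Z (ℤ.pred j) ≡
    carryRule (classAt Z (ℤ.pred (ℤ.pred (ℤ.pred j)))) (classAt Z (ℤ.pred (ℤ.pred j))) (classAt Z (ℤ.pred j))
              (classAt Z j) (classAt Z (ℤ.suc j))
  carry-left Z j = cong (λ k → carryRule (classAt Z (ℤ.pred (ℤ.pred (ℤ.pred j)))) (classAt Z (ℤ.pred (ℤ.pred j)))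
                                         (classAt Z (ℤ.pred j)) (classAt Z k) (classAt Z (ℤ.suc k)))
                        (ℤₚ.suc-pred j)

  carry-right : ∀ Z j → carry Z (ℤ.suc j) ≡
    carryRule (classAt Z (ℤ.pred j)) (classAt Z j) (classAt Z (ℤ.suc j))
              (classAt Z (ℤ.suc (ℤ.suc j))) (classAt Z (ℤ.suc (ℤ.suc (ℤ.suc j))))
  carry-right Z j = cong (λ k → carryRule (classAt Z (ℤ.pred k)) (classAt Z k) (classAt Z (ℤ.suc j))
                                          (classAt Z (ℤ.suc (ℤ.suc j))) (classAt Z (ℤ.suc (ℤ.suc (ℤ.suc j)))))
                         (ℤₚ.pred-suc j)

  carry-admissible : ∀ Z j → admissible (classAt Z j) (carry Z (ℤ.pred j)) (carry Z j) (carry Z (ℤ.suc j)) ≡ true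
  carry-admissible Z j rewrite carry-left Z j | carry-right Z j =
    carryRule-admissible (classAt Z (ℤ.pred (ℤ.pred (ℤ.pred j)))) (classAt Z (ℤ.pred (ℤ.pred j))) (classAt Z (ℤ.pred j))
                         (classAt Z j)
                         (classAt Z (ℤ.suc j)) (classAt Z (ℤ.suc (ℤ.suc j))) (classAt Z (ℤ.suc (ℤ.suc (ℤ.suc j))))

  round-step : ∀ Z j → a · carry Z j ≤ received (Z j) (carry Z (ℤ.pred j)) (carry Z (ℤ.suc j)) ×
                       Progress (Z j) (round Z j)
  round-step Z j = round-sound _ _ _ (class-view (Z j)) (carry-admissible Z j)

  progress-bound : ∀ {z z′ m} → Progress z z′ → z ≤ N + suc m → z′ ≤ N + m
  progress-bound {m = m} (inj₁ z′≤N) _       = ℕₚ.≤-trans z′≤N (ℕₚ.m≤m+n N m)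
  progress-bound {m = m} (inj₂ z′<z) z≤N+1+m = ℕₚ.≤-pred (ℕₚ.≤-trans z′<z (ℕₚ.≤-trans z≤N+1+m (ℕₚ.≤-reflexive (ℕₚ.+-suc N m))))

  rounds-bound : ∀ {z} k m → (∀ j → z j ≤ N + (k + m)) → ∀ j → rounds k z j ≤ N + m
  rounds-bound zero    m z≤ j = z≤ j
  rounds-bound {z} (suc k) m z≤ j = progress-bound (proj₂ (round-step (rounds k z) j))
    (rounds-bound k (suc m) (λ i → ℕₚ.≤-trans (z≤ i) (ℕₚ.≤-reflexive (cong (λ n → N + n) (sym (ℕₚ.+-suc k m))))) j)

  Vanishes : ℕ → (ℤ → ℕ) → Set
  Vanishes M Z = ∀ j → M < ∣ j ∣ → Z j ≡ 0

  carry-zero : ∀ Z j → Z j ≡ 0 → carry Z j ≡ false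
  carry-zero Z j Zj≡0 = cong (λ z → carryRule (classAt Z (ℤ.pred (ℤ.pred j))) (classAt Z (ℤ.pred j)) (class z)
                                              (classAt Z (ℤ.suc j)) (classAt Z (ℤ.suc (ℤ.suc j)))) Zj≡0

  newDigit-cong : ∀ {z z′ A A′ B B′ C C′} → z ≡ z′ → A ≡ A′ → B ≡ B′ → C ≡ C′ →
                  newDigit z A B C ≡ newDigit z′ A′ B′ C′
  newDigit-cong refl refl refl refl = refl

  round-support : ∀ {M Z} → Vanishes M Z → Vanishes (suc M) (round Z)
  round-support {M} {Z} Z≡0 j M+1<|j| = newDigit-cong (Z≡0 j M<|j|) (carry-zero Z _ (Z≡0 _ (far-neighbour j ℤ.-1ℤ ℕₚ.≤-refl M+1<|j|)))
      (carry-zero Z j (Z≡0 j M<|j|)) (carry-zero Z _ (Z≡0 _ (far-neighbour j ℤ.1ℤ ℕₚ.≤-refl M+1<|j|)))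
    where
    M<|j| : M < ∣ j ∣
    M<|j| = ℕₚ.<-trans (ℕₚ.n<1+n M) M+1<|j|

  rounds-support : ∀ {M z} → Vanishes M z → ∀ k → Vanishes (k + M) (rounds k z)
  rounds-support z≡0 zero    = z≡0
  rounds-support z≡0 (suc k) = round-support (rounds-support z≡0 k)

  carryRule-cong : ∀ {x₁ x₂ x₃ x₄ x₅ y₁ y₂ y₃ y₄ y₅} → x₁ ≡ y₁ → x₂ ≡ y₂ → x₃ ≡ y₃ → x₄ ≡ y₄ → x₅ ≡ y₅ →
    carryRule (class x₁) (class x₂) (class x₃) (class x₄) (class x₅) ≡ carryRule (class y₁) (class y₂) (class y₃) (class y₄) (class y₅)
  carryRule-cong refl refl refl refl refl = refl

  carry-radius : HasRadius 2 carry
  carry-radius agree = carryRule-cong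
    (agree-at agree -[1+ 1 ] (ℤ.pred ∘ ℤ.pred) (s≤s (s≤s z≤n)) two-back)
    (agree-at agree ℤ.-1ℤ ℤ.pred (s≤s z≤n) (λ _ → refl))
    (agree-at agree (+ 0) (λ k → k) z≤n (λ k → sym (ℤₚ.+-identityˡ k)))
    (agree-at agree ℤ.1ℤ ℤ.suc (s≤s z≤n) (λ _ → refl))
    (agree-at agree (+ 2) (ℤ.suc ∘ ℤ.suc) ℕₚ.≤-refl two-on)
    where
    two-back : ∀ k → -[1+ 0 ] ℤ.+ (-[1+ 0 ] ℤ.+ k) ≡ -[1+ 1 ] ℤ.+ k
    two-back = solve-∀
    two-on : ∀ k → + 1 ℤ.+ (+ 1 ℤ.+ k) ≡ + 2 ℤ.+ k
    two-on = solve-∀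

  round-radius : HasRadius 3 round
  round-radius {Z} {Z′} {j} {j′} agree = newDigit-cong
    (agree-at agree (+ 0) (λ k → k) z≤n (λ k → sym (ℤₚ.+-identityˡ k)))
    (carry-radius {Z} {Z′} (agree-shift {s = 1} ℤ.-1ℤ ℕₚ.≤-refl agree))
    (carry-radius {Z} {Z′} (agree-weaken (ℕₚ.n≤1+n 2) agree))
    (carry-radius {Z} {Z′} (agree-shift {s = 1} ℤ.1ℤ ℕₚ.≤-refl agree))

  rounds-radius : ∀ k → HasRadius (k * 3) (rounds k)
  rounds-radius zero    agree = agree-at agree (+ 0) (λ k → k) z≤n (λ k → sym (ℤₚ.+-identityˡ k))
  rounds-radius (suc k) = radius-∘ {F = rounds k} {G = round} (rounds-radius k) round-radius

  bit : Bool → ℤ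
  bit B = + (1 · B)

  totalCarry : ℕ → (ℤ → ℕ) → ℤ → ℤ
  totalCarry zero    z j = + 0
  totalCarry (suc k) z j = totalCarry k z j ℤ.+ bit (carry (rounds k z) j)

  ·-as-product : ∀ n B → + (n · B) ≡ + n ℤ.* bit B
  ·-as-product n true  = sym (ℤₚ.*-identityʳ (+ n))
  ·-as-product n false = sym (ℤₚ.*-zeroʳ (+ n))

  pos-∸ : ∀ {m n} → n ≤ m → + (m ∸ n) ≡ + m ℤ.- + n
  pos-∸ {m} {n} n≤m = sym (trans (ℤₚ.m-n≡m⊖n m n) (ℤₚ.⊖-≥ n≤m))

  round-value : ∀ Z j → + Z j ℤ.- + round Z j ≡ carryPattern a b (bit ∘ carry Z) j
  round-value Z j = begin
    + Z j ℤ.- + round Z j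
      ≡⟨ cong (λ x → + Z j ℤ.- x) (pos-∸ (proj₁ (round-step Z j))) ⟩
    + Z j ℤ.- (+ (Z j + 1 · A + b · C) ℤ.- + (a · B))
      ≡⟨ cong₂ (λ x y → + Z j ℤ.- (x ℤ.- y)) received≡ (·-as-product a B) ⟩
    + Z j ℤ.- ((+ Z j ℤ.+ bit A ℤ.+ + b ℤ.* bit C) ℤ.- + a ℤ.* bit B)
      ≡⟨ rearrange (+ Z j) (+ a) (+ b) (bit A) (bit B) (bit C) ⟩
    carryPattern a b (bit ∘ carry Z) j ∎
    where
    open ≡-Reasoning
    A B C : Bool
    A = carry Z (ℤ.pred j)
    B = carry Z j
    C = carry Z (ℤ.suc j)
    received≡ : + (Z j + 1 · A + b · C) ≡ + Z j ℤ.+ bit A ℤ.+ + b ℤ.* bit C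
    received≡ = trans (ℤₚ.pos-+ (Z j + 1 · A) (b · C)) (cong₂ ℤ._+_ (ℤₚ.pos-+ (Z j) (1 · A)) (·-as-product b C))
    rearrange : ∀ z A B qₗ q qᵣ → z ℤ.- ((z ℤ.+ qₗ ℤ.+ B ℤ.* qᵣ) ℤ.- A ℤ.* q) ≡ A ℤ.* q ℤ.- qₗ ℤ.- B ℤ.* qᵣ
    rearrange = solve-∀

  carryPattern-+ : ∀ Q Q′ j → carryPattern a b Q j ℤ.+ carryPattern a b Q′ j ≡ carryPattern a b (λ i → Q i ℤ.+ Q′ i) j
  carryPattern-+ Q Q′ j = distribute (+ a) (+ b) (Q (ℤ.pred j)) (Q j) (Q (ℤ.suc j)) (Q′ (ℤ.pred j)) (Q′ j) (Q′ (ℤ.suc j))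
    where
    distribute : ∀ A B x₋ x x₊ y₋ y y₊ → (A ℤ.* x ℤ.- x₋ ℤ.- B ℤ.* x₊) ℤ.+ (A ℤ.* y ℤ.- y₋ ℤ.- B ℤ.* y₊) ≡
                                        A ℤ.* (x ℤ.+ y) ℤ.- (x₋ ℤ.+ y₋) ℤ.- B ℤ.* (x₊ ℤ.+ y₊)
    distribute = solve-∀

  rounds-value : ∀ z k j → + z j ℤ.- + rounds k z j ≡ carryPattern a b (totalCarry k z) j
  rounds-value z zero    j = nothing-moved (+ z j) (+ a) (+ b)
    where
    nothing-moved : ∀ x A B → x ℤ.- x ≡ A ℤ.* + 0 ℤ.- + 0 ℤ.- B ℤ.* + 0
    nothing-moved = solve-∀
  rounds-value z (suc k) j = begin
    + z j ℤ.- + round Zₖ j                          ≡⟨ split (+ z j) (+ Zₖ j) (+ round Zₖ j) ⟩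
    (+ z j ℤ.- + Zₖ j) ℤ.+ (+ Zₖ j ℤ.- + round Zₖ j) ≡⟨ cong₂ ℤ._+_ (rounds-value z k j) (round-value Zₖ j) ⟩
    carryPattern a b (totalCarry k z) j ℤ.+ carryPattern a b (bit ∘ carry Zₖ) j
                                                    ≡⟨ carryPattern-+ (totalCarry k z) (bit ∘ carry Zₖ) j ⟩
    carryPattern a b (totalCarry (suc k) z) j       ∎
    where
    open ≡-Reasoning
    Zₖ : ℤ → ℕ
    Zₖ = rounds k z
    split : ∀ x y w → x ℤ.- w ≡ (x ℤ.- y) ℤ.+ (y ℤ.- w)
    split = solve-∀

  totalCarry-support : ∀ {M z} → Vanishes M z → ∀ k j → k + M < ∣ j ∣ → totalCarry k z j ≡ + 0
  totalCarry-support z≡0 zero    j _ = refl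
  totalCarry-support {M} {z} z≡0 (suc k) j k+1+M<|j| =
    cong₂ (λ x B → x ℤ.+ bit B) (totalCarry-support z≡0 k j k+M<|j|)
                                 (carry-zero (rounds k z) j (rounds-support z≡0 k j k+M<|j|))
    where
    k+M<|j| : k + M < ∣ j ∣
    k+M<|j| = ℕₚ.<-trans (ℕₚ.n<1+n (k + M)) k+1+M<|j|

  digits : ∀ {k} → Seq k → ℤ → ℕ
  digits u j = toℕ (u j)

  φ : Seq (2 * N) → Seq N
  φ u j = rounds N (digits u) j mod suc N

  normalised : ∀ u j → rounds N (digits u) j ≤ N
  normalised u j = ℕₚ.≤-trans (rounds-bound N 0 (λ i → ℕₚ.≤-pred (toℕ<n (u i))) j)
                              (ℕₚ.≤-reflexive (ℕₚ.+-identityʳ N))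

  toℕ-φ : ∀ u j → toℕ (φ u j) ≡ rounds N (digits u) j
  toℕ-φ u j = toℕ-mod (normalised u j)

  digits-vanish : ∀ {k M} {u : Seq k} → BoundedBy M u → Vanishes M (digits u)
  digits-vanish u≡0 j M<|j| = cong toℕ (u≡0 j M<|j|)

  φ-finite : ∀ u → FinSupp u → FinSupp (φ u)
  φ-finite u (M , u≡0) = N + M , λ j N+M<|j| → cong (λ x → x mod suc N) (rounds-support (digits-vanish u≡0) N j N+M<|j|)

  φ-value : ∀ u M → BoundedBy M u → BoundedBy M (φ u) → SameValue a b M u (φ u)
  φ-value u M u≡0 φu≡0 = subst (EvalZero a b) (sym differences≡window)
    (carryPattern-value-zero a b′ Q M (N + M) pattern≡0 (totalCarry-support (digits-vanish u≡0) N))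
    where
    Q : ℤ → ℤ
    Q = totalCarry N (digits u)
    difference≡ : ∀ j → digitℤ (u j) ℤ.- digitℤ (φ u j) ≡ carryPattern a b Q j
    difference≡ j = trans (cong (λ n → + toℕ (u j) ℤ.- + n) (toℕ-φ u j)) (rounds-value (digits u) N j)
    pattern≡0 : ∀ j → M < ∣ j ∣ → carryPattern a b Q j ≡ + 0
    pattern≡0 j M<|j| = trans (sym (difference≡ j)) (cong₂ (λ x y → digitℤ x ℤ.- digitℤ y) (u≡0 j M<|j|) (φu≡0 j M<|j|))
    index : ∀ i → + i ℤ.- + M ≡ (ℤ.- + M) ⊕ i
    index i = trans (ℤₚ.+-comm (+ i) (ℤ.- + M)) (sym (⊕-+ (ℤ.- + M) i))
    differences≡window : map (λ i → digitℤ (u (+ i ℤ.- + M)) ℤ.- digitℤ (φ u (+ i ℤ.- + M))) (upTo (suc (M + M)))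
                         ≡ window (carryPattern a b Q) (ℤ.- + M) (suc (M + M))
    differences≡window = trans (map-upTo _ (suc (M + M)))
      (window-applyUpTo (carryPattern a b Q) (ℤ.- + M) (suc (M + M)) _
         (λ i → trans (difference≡ (+ i ℤ.- + M)) (cong (carryPattern a b Q) (index i))))

  R : ℕ
  R = N * 3

  φ-local : IsLocal (suc (R + R)) φ
  φ-local = R , R , ℕₚ.+-comm 1 (R + R) , (λ w → φ (recentre R w) (+ 0)) , λ u j →
    cong (λ x → x mod suc N) (rounds-radius N (agreeing λ i |i|≤R → cong toℕ (sym (
      trans (cong (recentre R (windowAt R u j)) (ℤₚ.+-identityʳ i)) (recentre-window R u j i |i|≤R)))))

base-shape : ∀ a b′ → suc b′ + 2 ≤ a → Σ ℕ λ a′ → a ≡ 3 + a′ × b′ ≤ a′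
base-shape a b′ b+2≤a = shape (subst (_≤ a) (ℕₚ.+-comm (suc b′) 2) b+2≤a)
  where
  shape : ∀ {a} → 3 + b′ ≤ a → Σ ℕ λ a′ → a ≡ 3 + a′ × b′ ≤ a′
  shape (s≤s (s≤s (s≤s b′≤a′))) = _ , refl , b′≤a′

proposition17 : (a b : ℕ) → b + 2 ≤ a → 1 ≤ b →
    ∃ λ (φ : Seq (2 * (a + b ∸ 2)) → Seq (a + b ∸ 2)) →
      DigitSetConversion a b φ × ∃ λ p → IsLocal p φ
proposition17 a zero     _     ()
proposition17 a (suc b′) b+2≤a _ with base-shape a b′ b+2≤a
... | a′ , refl , b′≤a′ = φ , (φ-finite , φ-value) , suc (R + R) , φ-local
  where open Rounds a′ b′ b′≤a′
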